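{- Let $m>n$. The minimum size of a treelike Resolution refutation of $\mathrm{BinPHP}^m_n$ is $2^{\Theta(n)}$.
   Context: $n$ is a power of 2; for a hole $a\in[n]$, $a_1\dots a_{\log n}$ is its binary representation; $\omega^1=\omega$, $\omega^0=\neg\omega$. $\mathrm{BinPHP}^m_n$ has variables $\omega_{i,\ell}$ ($i\in[m]$ pigeons, $\ell\in[\log n]$) and, for all $i\neq i'\in[m]$, $a\in[n]$, the clause $\bigvee_{\ell}\omega_{i,\ell}^{1-a_\ell}\vee\bigvee_\ell\omega_{i',\ell}^{1-a_\ell}$. A treelike Resolution refutation is a Resolution refutation whose underlying derivation graph is a tree (each derived clause is used at most once); size is the number of inference steps. -}

module Defs where

open import Data.Nat using (ℕ; zero; suc; _+_)
open import Data.Fin using (Fin) renaming (_≟_ to _≟ᶠ_)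
open import Data.Bool using (Bool; true; false; _∧_; _∨_; not) renaming (_≟_ to _≟ᵇ_)
open import Data.Product using (Σ; ∃; _×_; _,_)
open import Relation.Nullary using (¬_; does)
open import Relation.Binary.PropositionalEquality using (_≡_)

-- Generic propositional Resolution over variables Fin m × Fin k
-- (pigeon i, bit position ℓ).  n = 2 ^ k holes.

-- A literal: variable ω_{i,ℓ} together with a polarity b;
-- polarity true means ω^1 = ω, false means ω^0 = ¬ω.
Lit : ℕ → ℕ → Set
Lit m k = Fin m × Fin k × Bool

Clause : ℕ → ℕ → Set
Clause m k = Lit m k → Bool

_==ᴸ_ : ∀ {m k} → Lit m k → Lit m k → Bool
(i , ℓ , b) ==ᴸ (i' , ℓ' , b') = does (i ≟ᶠ i') ∧ does (ℓ ≟ᶠ ℓ') ∧ does (b ≟ᵇ b')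

CNF : ℕ → ℕ → Set₁
CNF m k = Clause m k → Set

⊥ᶜ : ∀ {m k} → Clause m k
⊥ᶜ _ = false

resolvent : ∀ {m k} → Fin m → Fin k → Clause m k → Clause m k → Clause m k
resolvent i ℓ C D l =
  (C l ∧ not (l ==ᴸ (i , ℓ , true))) ∨ (D l ∧ not (l ==ᴸ (i , ℓ , false)))

-- Treelike Resolution derivations: a tree whose leaves are initial clauses
-- and whose inner nodes are resolution steps.  Being a tree, each derived
-- clause is used at most once.
data Deriv {m k : ℕ} (F : CNF m k) : Clause m k → Set where
  axiom   : ∀ {C} → F C → Deriv F C
  resolve : ∀ {C D} (i : Fin m) (ℓ : Fin k) →
            Deriv F C → Deriv F D →
            C (i , ℓ , true) ≡ true → D (i , ℓ , false) ≡ true →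
            (E : Clause m k) → (∀ l → E l ≡ resolvent i ℓ C D l) →
            Deriv F E

size : ∀ {m k} {F : CNF m k} {C} → Deriv F C → ℕ
size (axiom _) = 0
size (resolve _ _ π ρ _ _ _ _) = suc (size π + size ρ)

Refutation : ∀ {m k} → CNF m k → Set
Refutation F = Deriv F ⊥ᶜ

-- BinPHP^m_n with n = 2 ^ k.  A hole a ∈ [n] is identified with its
-- binary representation a_1 … a_k, i.e. a function Fin k → Bool.

binClause : ∀ {m k} → Fin m → Fin m → (Fin k → Bool) → Clause m k
binClause i i' a (j , ℓ , b) =
  (does (j ≟ᶠ i) ∨ does (j ≟ᶠ i')) ∧ does (b ≟ᵇ not (a ℓ))

BinPHP : (m k : ℕ) → CNF m k
BinPHP m k C =
  Σ (Fin m) λ i → Σ (Fin m) λ i' → Σ (Fin k → Bool) λ a →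
    (¬ (i ≡ i')) × (∀ l → C l ≡ binClause i i' a l)

module Submission where

-- A decision tree keeps a set P of 2 ^ r + 1 pigeons whose holes agree on all but
-- r bits.  It queries one of these bits for every pigeon of P, and by the pigeonhole principle
-- 2 ^ (r - 1) + 1 of them agree on it.  With no bit left, two pigeons of P share a hole and
-- falsify an axiom.  The tree has depth Σ (2 ^ r + 1) ≤ 4n, and resolving on the queried
-- variables bottom-up turns it into a treelike refutation with at most 2 ^ depth leaves.
--
-- In the Prover–Delayer game the Delayer splits the n holes into n/2 pairs of
-- complementary holes, which differ in every bit.  When a bit of an unplaced pigeon is queried,
-- she puts the pigeon into an unused pair and lets the Prover pick the hole, i.e. the bit, so
-- every pair forces a branching.  Since no two pigeons ever share a hole, no axiom gets
-- falsified, and every treelike refutation has at least 2 ^ (n/2) leaves.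

open import Defs
open import Data.Bool using (Bool; true; false; _∧_; _∨_; not; _xor_; if_then_else_)
  renaming (_≟_ to _≟ᵇ_)
open import Data.Bool.Properties
  using (not-involutive; ∨-zeroʳ; ∧-conicalˡ; ∧-conicalʳ; xor-assoc; xor-same; xor-identityʳ)
open import Data.Fin using (Fin; zero; suc) renaming (_≟_ to _≟ᶠ_)
open import Data.List using (List; []; _∷_; _++_; length; map; filter; take; allFin)
open import Data.List.Properties using (length-++; length-map; length-take; length-tabulate)
open import Data.List.Membership.Propositional using (_∉_)
open import Data.List.Membership.Propositional.Properties using (∈-allFin)
open import Data.List.Relation.Unary.All as All using (All; []; _∷_)
import Data.List.Relation.Unary.All.Properties as All
open import Data.List.Relation.Unary.AllPairs as AllPairs using (AllPairs; []; _∷_)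
import Data.List.Relation.Unary.AllPairs.Properties as AllPairs
open import Data.List.Relation.Unary.Any using (here; there)
open import Data.List.Relation.Unary.Unique.Propositional using (Unique)
import Data.List.Relation.Unary.Unique.Propositional.Properties as Unique
open import Data.Maybe using (Maybe; just; nothing)
open import Data.Maybe.Properties using (just-injective) renaming (≡-dec to ≡-decᴹ)
open import Data.Nat using (ℕ; zero; suc; _+_; _*_; _^_; _⊓_; _≤_; _<_; _/_; z≤n; s≤s; _<?_)
open import Data.Nat.DivMod using (m*n/n≡m)
open import Data.Nat.Properties
open import Data.Nat.Tactic.RingSolver using (solve-∀)
open import Data.Product using (Σ; ∃; _×_; _,_; proj₁; proj₂)
open import Data.Sum using (_⊎_; inj₁; inj₂)
import Data.Vec.Functional as V
open import Data.Vec.Functional.Properties using (updateAt-updates; updateAt-minimal)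
open import Function using (id; case_of_)
open import Relation.Binary.Definitions using (DecidableEquality)
open import Relation.Binary.PropositionalEquality
open import Relation.Nullary using (¬_; Dec; yes; no; does)
open import Relation.Nullary.Decidable using (dec-true; dec-false)
open import Relation.Nullary.Negation using (contradiction)

_≟ᴹ_ : DecidableEquality (Maybe Bool)
_≟ᴹ_ = ≡-decᴹ _≟ᵇ_

Partial : ℕ → ℕ → Set
Partial m k = Fin m → Fin k → Maybe Bool

∨-true : ∀ {a b} → a ∨ b ≡ true → a ≡ true ⊎ b ≡ true
∨-true {true}  _ = inj₁ refl
∨-true {false} e = inj₂ e

2^[1+n]≡2^n+2^n : ∀ r → 2 ^ suc r ≡ 2 ^ r + 2 ^ r
2^[1+n]≡2^n+2^n r = cong (2 ^ r +_) (+-identityʳ (2 ^ r))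

2+m+n≡[1+m]+[1+n] : ∀ a b → suc (suc (a + b)) ≡ suc a + suc b
2+m+n≡[1+m]+[1+n] a b = cong suc (sym (+-suc a b))

module _ {m k : ℕ} where

  _⊑_ : Partial m k → Partial m k → Set
  ρ ⊑ σ = ∀ i ℓ {v} → ρ i ℓ ≡ just v → σ i ℓ ≡ just v

  set : Partial m k → Fin m → Fin k → Bool → Partial m k
  set ρ i ℓ v j ℓ' = if does (j ≟ᶠ i) ∧ does (ℓ' ≟ᶠ ℓ) then just v else ρ j ℓ'

  set-updates : ∀ ρ i ℓ v → set ρ i ℓ v i ℓ ≡ just v
  set-updates ρ i ℓ v rewrite dec-true (i ≟ᶠ i) refl | dec-true (ℓ ≟ᶠ ℓ) refl = refl

  set-view : ∀ ρ i ℓ v j ℓ' →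
             (j ≡ i × ℓ' ≡ ℓ × set ρ i ℓ v j ℓ' ≡ just v) ⊎ set ρ i ℓ v j ℓ' ≡ ρ j ℓ'
  set-view ρ i ℓ v j ℓ' with j ≟ᶠ i | ℓ' ≟ᶠ ℓ
  ... | yes j≡i | yes ℓ'≡ℓ = inj₁ (j≡i , ℓ'≡ℓ , refl)
  ... | yes _   | no _     = inj₂ refl
  ... | no _    | _        = inj₂ refl

  ⊑-set : ∀ {ρ i ℓ} v → ρ i ℓ ≡ nothing → ρ ⊑ set ρ i ℓ v
  ⊑-set {ρ} {i} {ℓ} v ρiℓ j ℓ' ρjℓ' with set-view ρ i ℓ v j ℓ'
  ... | inj₁ (refl , refl , _) = contradiction (trans (sym ρiℓ) ρjℓ') λ ()
  ... | inj₂ e                 = trans e ρjℓ'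

  FalsifiesLit : Partial m k → Lit m k → Set
  FalsifiesLit ρ (i , ℓ , b) = ρ i ℓ ≡ just (not b)

  Falsifies : Partial m k → Clause m k → Set
  Falsifies ρ C = ∀ l → C l ≡ true → FalsifiesLit ρ l

  falsifies-⊑ : ∀ {ρ σ C} → ρ ⊑ σ → Falsifies ρ C → Falsifies σ C
  falsifies-⊑ ρ⊑σ ρ⊭C (i , ℓ , b) Cl = ρ⊑σ i ℓ (ρ⊭C (i , ℓ , b) Cl)

  falsifiesLit-set : ∀ {ρ i ℓ v} l → FalsifiesLit (set ρ i ℓ v) l → l ≢ (i , ℓ , not v) →
                     FalsifiesLit ρ l
  falsifiesLit-set {ρ} {i} {ℓ} {v} (j , ℓ' , b) e l≢x with set-view ρ i ℓ v j ℓ'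
  ... | inj₁ (refl , refl , e') = contradiction (cong (λ b → j , ℓ' , b) b≡¬v) l≢x
    where
    b≡¬v : b ≡ not v
    b≡¬v = trans (sym (not-involutive b)) (cong not (just-injective (trans (sym e) e')))
  ... | inj₂ e' = trans (sym e') e

  ==ᴸ-refl : ∀ (l : Lit m k) → (l ==ᴸ l) ≡ true
  ==ᴸ-refl (i , ℓ , b)
    rewrite dec-true (i ≟ᶠ i) refl | dec-true (ℓ ≟ᶠ ℓ) refl | dec-true (b ≟ᵇ b) refl = refl

  ==ᴸ-sound : ∀ (l l' : Lit m k) → (l ==ᴸ l') ≡ true → l ≡ l'
  ==ᴸ-sound (i , ℓ , b) (i' , ℓ' , b') e with i ≟ᶠ i' | ℓ ≟ᶠ ℓ' | b ≟ᵇ b'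
  ... | yes refl | yes refl | yes refl = refl
  ... | no _     | _        | _        = contradiction e λ ()
  ... | yes _    | no _     | _        = contradiction e λ ()
  ... | yes _    | yes _    | no _     = contradiction e λ ()

  not-==ᴸ⇒≢ : ∀ {l l' : Lit m k} → not (l ==ᴸ l') ≡ true → l ≢ l'
  not-==ᴸ⇒≢ {l} e refl = contradiction (trans (sym e) (cong not (==ᴸ-refl l))) λ ()

  ≢⇒not-==ᴸ : ∀ {l l' : Lit m k} → l ≢ l' → not (l ==ᴸ l') ≡ true
  ≢⇒not-==ᴸ {l} {l'} l≢l' with l ==ᴸ l' in e
  ... | true  = contradiction (==ᴸ-sound l l' e) l≢l'
  ... | false = refl

  resolvent-true : ∀ {i ℓ C D} l → resolvent i ℓ C D l ≡ true →
                   (C l ≡ true × l ≢ (i , ℓ , true)) ⊎ (D l ≡ true × l ≢ (i , ℓ , false))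
  resolvent-true {C = C} {D} l e with ∨-true e
  ... | inj₁ e' = inj₁ (∧-conicalˡ (C l) _ e' , not-==ᴸ⇒≢ (∧-conicalʳ (C l) _ e'))
  ... | inj₂ e' = inj₂ (∧-conicalˡ (D l) _ e' , not-==ᴸ⇒≢ (∧-conicalʳ (D l) _ e'))

  resolvent-trueˡ : ∀ {i ℓ C D} l → C l ≡ true → l ≢ (i , ℓ , true) → resolvent i ℓ C D l ≡ true
  resolvent-trueˡ l Cl l≢x rewrite Cl | ≢⇒not-==ᴸ l≢x = refl

  resolvent-trueʳ : ∀ {i ℓ C D} l → D l ≡ true → l ≢ (i , ℓ , false) → resolvent i ℓ C D l ≡ true
  resolvent-trueʳ l Dl l≢x rewrite Dl | ≢⇒not-==ᴸ l≢x = ∨-zeroʳ _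

  falsifies-premiseˡ : ∀ {ρ i ℓ C D E} → (∀ l → E l ≡ resolvent i ℓ C D l) →
                       Falsifies ρ E → ρ i ℓ ≡ just false → Falsifies ρ C
  falsifies-premiseˡ {i = i} {ℓ} {C} {D} E≗ ρ⊭E ρx l Cl with l ==ᴸ (i , ℓ , true) in e
  ... | true with refl ← ==ᴸ-sound l _ e = ρx
  ... | false = ρ⊭E l (trans (E≗ l) (resolvent-trueˡ {C = C} {D} l Cl (not-==ᴸ⇒≢ (cong not e))))

  falsifies-premiseʳ : ∀ {ρ i ℓ C D E} → (∀ l → E l ≡ resolvent i ℓ C D l) →
                       Falsifies ρ E → ρ i ℓ ≡ just true → Falsifies ρ D
  falsifies-premiseʳ {i = i} {ℓ} {C} {D} E≗ ρ⊭E ρx l Dl with l ==ᴸ (i , ℓ , false) in e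
  ... | true with refl ← ==ᴸ-sound l _ e = ρx
  ... | false = ρ⊭E l (trans (E≗ l) (resolvent-trueʳ {C = C} {D} l Dl (not-==ᴸ⇒≢ (cong not e))))

  falsifies-unset : ∀ {ρ i ℓ v C} → Falsifies (set ρ i ℓ v) C → C (i , ℓ , not v) ≡ false →
                    Falsifies ρ C
  falsifies-unset {ρ} {i} {ℓ} {v} ρᵥ⊭C Cx l Cl =
    falsifiesLit-set {ρ} {i} {ℓ} {v} l (ρᵥ⊭C l Cl) λ { refl → contradiction (trans (sym Cl) Cx) λ () }

  falsifies-resolvent : ∀ {ρ i ℓ C D} → Falsifies (set ρ i ℓ false) C → Falsifies (set ρ i ℓ true) D →
                        Falsifies ρ (resolvent i ℓ C D)
  falsifies-resolvent {ρ} {i} {ℓ} {C} {D} ρ₀⊭C ρ₁⊭D l e with resolvent-true {C = C} {D} l e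
  ... | inj₁ (Cl , l≢x) = falsifiesLit-set {ρ} {i} {ℓ} l (ρ₀⊭C l Cl) l≢x
  ... | inj₂ (Dl , l≢x) = falsifiesLit-set {ρ} {i} {ℓ} l (ρ₁⊭D l Dl) l≢x

  -- From decision trees to treelike refutations

  Extensional : CNF m k → Set
  Extensional F = ∀ {C D} → (∀ l → C l ≡ D l) → F C → F D

  deriv-resp-≗ : ∀ {F C D} → Extensional F → (π : Deriv F C) → (∀ l → C l ≡ D l) →
                 Σ (Deriv F D) λ π' → size π' ≡ size π
  deriv-resp-≗ F-ext (axiom FC) C≗D = axiom (F-ext C≗D FC) , refl
  deriv-resp-≗ F-ext (resolve i ℓ π σ Cx Dx E E≗) E≗D =
    resolve i ℓ π σ Cx Dx _ (λ l → trans (sym (E≗D l)) (E≗ l)) , refl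

  -- F restricted by ρ has a treelike refutation with at most 2 ^ d leaves (a derivation π has
  -- suc (size π) leaves).
  Refutable : CNF m k → ℕ → Partial m k → Set
  Refutable F d ρ = Σ (Clause m k) λ D → Σ (Deriv F D) λ π → Falsifies ρ D × suc (size π) ≤ 2 ^ d

  refutable-mono : ∀ {F d d' ρ} → d ≤ d' → Refutable F d ρ → Refutable F d' ρ
  refutable-mono d≤d' (D , π , ρ⊭D , leaves) = D , π , ρ⊭D , ≤-trans leaves (^-monoʳ-≤ 2 d≤d')

  refutable-branch : ∀ {F d ρ} i ℓ → Refutable F d (set ρ i ℓ false) → Refutable F d (set ρ i ℓ true) →
                     Refutable F (suc d) ρ
  refutable-branch {d = d} i ℓ (C , π , ρ₀⊭C , π≤) (D , σ , ρ₁⊭D , σ≤)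
    with C (i , ℓ , true) in Cx | D (i , ℓ , false) in Dx
  ... | false | _     = C , π , falsifies-unset ρ₀⊭C Cx , ≤-trans π≤ (^-monoʳ-≤ 2 (n≤1+n d))
  ... | true  | false = D , σ , falsifies-unset ρ₁⊭D Dx , ≤-trans σ≤ (^-monoʳ-≤ 2 (n≤1+n d))
  ... | true  | true  =
    resolvent i ℓ C D , resolve i ℓ π σ Cx Dx _ (λ _ → refl) , falsifies-resolvent ρ₀⊭C ρ₁⊭D ,
    subst₂ _≤_ (sym (2+m+n≡[1+m]+[1+n] (size π) (size σ))) (sym (2^[1+n]≡2^n+2^n d)) (+-mono-≤ π≤ σ≤)

  Assigned : Partial m k → Fin m × Fin k → Set
  Assigned ρ (i , ℓ) = ∃ λ v → ρ i ℓ ≡ just v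

  refutable-query : ∀ {F d ρ} (xs : List (Fin m × Fin k)) →
                    (∀ σ → ρ ⊑ σ → All (Assigned σ) xs → Refutable F d σ) →
                    Refutable F (length xs + d) ρ
  refutable-query [] refutable = refutable _ (λ _ _ ρx → ρx) []
  refutable-query {F} {d} {ρ} ((i , ℓ) ∷ xs) refutable with ρ i ℓ in ρx
  ... | just v  = refutable-mono {d = length xs + d} (n≤1+n _) (refutable-query xs λ σ ρ⊑σ σxs →
                   refutable σ ρ⊑σ ((v , ρ⊑σ i ℓ ρx) ∷ σxs))
  ... | nothing = refutable-branch {d = length xs + d} i ℓ (refutable-query xs (after false))
                                                           (refutable-query xs (after true))
    where
    after : ∀ v σ → set ρ i ℓ v ⊑ σ → All (Assigned σ) xs → Refutable F d σ
    after v σ ρᵥ⊑σ σxs =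
      refutable σ (λ j ℓ' ρx' → ρᵥ⊑σ j ℓ' (⊑-set v ρx j ℓ' ρx'))
                  ((v , ρᵥ⊑σ i ℓ (set-updates ρ i ℓ v)) ∷ σxs)

  refutation-from-refutable : ∀ {F d} → Extensional F → Refutable F d (λ _ _ → nothing) →
                              Σ (Refutation F) λ π → suc (size π) ≤ 2 ^ d
  refutation-from-refutable F-ext (D , π , ∅⊭D , π≤) with deriv-resp-≗ F-ext π D≗⊥
    where
    D≗⊥ : ∀ l → D l ≡ ⊥ᶜ l
    D≗⊥ l with D l in Dl
    ... | false = refl
    ... | true  = contradiction (∅⊭D l Dl) λ ()
  ... | π' , same-size = π' , subst (λ s → suc s ≤ _) (sym same-size) π≤

  -- The Prover–Delayer lower bound

  -- Safe r ρ: from the position ρ the Delayer can still force r branchings.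
  record DelayerStrategy (F : CNF m k) : Set₁ where
    field
      Safe            : ℕ → Partial m k → Set
      safe-consistent : ∀ {r ρ C} → Safe r ρ → F C → ¬ Falsifies ρ C
      safe-branch     : ∀ {r ρ} i ℓ → Safe (suc r) ρ → ρ i ℓ ≡ nothing →
                        ∀ v → Σ (Partial m k) λ σ → ρ ⊑ σ × σ i ℓ ≡ just v × Safe r σ

  module _ {F : CNF m k} (S : DelayerStrategy F) where
    open DelayerStrategy S

    delayer-lower-bound : ∀ {r ρ C} → Safe r ρ → Falsifies ρ C → (π : Deriv F C) → 2 ^ r ≤ suc (size π)
    delayer-lower-bound {zero} _ _ _ = s≤s z≤n
    delayer-lower-bound safe ρ⊭C (axiom FC) = contradiction ρ⊭C (safe-consistent safe FC)
    delayer-lower-bound {suc r} {ρ} safe ρ⊭E (resolve i ℓ π σ _ _ E E≗) with ρ i ℓ in ρx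
    ... | just false = ≤-trans (delayer-lower-bound safe (falsifies-premiseˡ E≗ ρ⊭E ρx) π)
                               (s≤s (≤-trans (m≤m+n _ _) (n≤1+n _)))
    ... | just true  = ≤-trans (delayer-lower-bound safe (falsifies-premiseʳ E≗ ρ⊭E ρx) σ)
                               (s≤s (≤-trans (m≤n+m _ _) (n≤1+n _)))
    ... | nothing    = subst₂ _≤_ (sym (2^[1+n]≡2^n+2^n r)) (sym (2+m+n≡[1+m]+[1+n] (size π) (size σ)))
                                  (+-mono-≤ (branch false π (falsifies-premiseˡ E≗))
                                            (branch true σ (falsifies-premiseʳ E≗)))
      where
      branch : ∀ v {C'} (π' : Deriv F C') →
               (∀ {ρ'} → Falsifies ρ' E → ρ' i ℓ ≡ just v → Falsifies ρ' C') → 2 ^ r ≤ suc (size π')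
      branch v π' premise with safe-branch i ℓ safe ρx v
      ... | ρ' , ρ⊑ρ' , ρ'x , safe' = delayer-lower-bound safe' (premise (falsifies-⊑ ρ⊑ρ' ρ⊭E) ρ'x) π'

Hole : ℕ → Set
Hole k = Fin k → Bool

module _ {m k : ℕ} where

  record InHole (ρ : Partial m k) (i : Fin m) (a : Hole k) : Set where
    constructor in-hole
    field bit : ∀ ℓ → ρ i ℓ ≡ just (a ℓ)

  open InHole public

  binClause-true : ∀ {i i' : Fin m} {a : Hole k} j ℓ b → binClause i i' a (j , ℓ , b) ≡ true →
                   (j ≡ i ⊎ j ≡ i') × b ≡ not (a ℓ)
  binClause-true {i} {i'} {a} j ℓ b e with j ≟ᶠ i | j ≟ᶠ i' | b ≟ᵇ not (a ℓ)
  ... | yes j≡i | _        | yes b≡ = inj₁ j≡i , b≡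
  ... | no _    | yes j≡i' | yes b≡ = inj₂ j≡i' , b≡
  ... | yes _   | _        | no _   = contradiction e λ ()
  ... | no _    | yes _    | no _   = contradiction e λ ()
  ... | no _    | no _     | _      = contradiction e λ ()

  binClause-contains : ∀ {i i' : Fin m} {a : Hole k} j ℓ → j ≡ i ⊎ j ≡ i' →
                       binClause i i' a (j , ℓ , not (a ℓ)) ≡ true
  binClause-contains {i} {i'} {a} j ℓ j∈ii' rewrite dec-true (not (a ℓ) ≟ᵇ not (a ℓ)) refl with j∈ii'
  ... | inj₁ j≡i  rewrite dec-true (j ≟ᶠ i) j≡i = refl
  ... | inj₂ j≡i' rewrite dec-true (j ≟ᶠ i') j≡i' | ∨-zeroʳ (does (j ≟ᶠ i)) = refl

  falsifies-binClause⇒InHole : ∀ {ρ i i'} {a : Hole k} → Falsifies ρ (binClause i i' a) →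
                               InHole ρ i a × InHole ρ i' a
  falsifies-binClause⇒InHole {ρ} {i} {i'} {a} ρ⊭C =
    in-hole (bits i (inj₁ refl)) , in-hole (bits i' (inj₂ refl))
    where
    bits : ∀ j → j ≡ i ⊎ j ≡ i' → ∀ ℓ → ρ j ℓ ≡ just (a ℓ)
    bits j j∈ii' ℓ =
      trans (ρ⊭C (j , ℓ , not (a ℓ)) (binClause-contains {a = a} j ℓ j∈ii'))
            (cong just (not-involutive (a ℓ)))

  InHole⇒falsifies-binClause : ∀ {ρ i i'} {a : Hole k} → InHole ρ i a → InHole ρ i' a →
                               Falsifies ρ (binClause i i' a)
  InHole⇒falsifies-binClause {a = a} in-i in-i' (j , ℓ , b) e with binClause-true {a = a} j ℓ b e
  ... | inj₁ refl , refl = trans (bit in-i ℓ) (cong just (sym (not-involutive (a ℓ))))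
  ... | inj₂ refl , refl = trans (bit in-i' ℓ) (cong just (sym (not-involutive (a ℓ))))

  binPHP-extensional : Extensional (BinPHP m k)
  binPHP-extensional C≗D (i , i' , a , i≢i' , C≗) = i , i' , a , i≢i' , λ l → trans (sym (C≗D l)) (C≗ l)

-- Upper bound for BinPHP

length-filter-just : ∀ {A : Set} (f : A → Maybe Bool) {xs} → All (λ x → ∃ λ v → f x ≡ just v) xs →
                     length (filter (λ x → f x ≟ᴹ just false) xs) +
                     length (filter (λ x → f x ≟ᴹ just true) xs) ≡ length xs
length-filter-just f [] = refl
length-filter-just f ((false , fx) ∷ defined) rewrite fx = cong suc (length-filter-just f defined)
length-filter-just f ((true , fx) ∷ defined) rewrite fx =
  trans (+-suc _ _) (cong suc (length-filter-just f defined))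

majority : ∀ {A : Set} (f : A → Maybe Bool) t {xs} → All (λ x → ∃ λ v → f x ≡ just v) xs →
           2 * t < length xs → ∃ λ v → t < length (filter (λ x → f x ≟ᴹ just v) xs)
majority {A} f t {xs} defined 2t<|xs| = case t <? length (valued false) of λ where
    (yes many) → false , many
    (no few)   → true , ≰⇒> λ few' → <⇒≱ 2t<|xs| (begin
      length xs                                    ≡⟨ sym (length-filter-just f defined) ⟩
      length (valued false) + length (valued true) ≤⟨ +-mono-≤ (≮⇒≥ few) few' ⟩
      t + t                                        ≡⟨ cong (t +_) (sym (+-identityʳ t)) ⟩
      2 * t                                        ∎)
  where
  open ≤-Reasoning
  valued : Bool → List A
  valued v = filter (λ x → f x ≟ᴹ just v) xs

-- With r bits left, the decision tree queries one bit of each of 2 ^ r + 1 pigeons.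
queryDepth : ℕ → ℕ
queryDepth zero    = 0
queryDepth (suc r) = suc (2 ^ suc r) + queryDepth r

module _ {m k : ℕ} where

  AgreeOutside : Partial m k → List (Fin m) → List (Fin k) → Set
  AgreeOutside ρ P L = ∀ ℓ → ℓ ∉ L → ∃ λ v → All (λ j → ρ j ℓ ≡ just v) P

  binPHP-refutable : ∀ (L : List (Fin k)) {ρ P} → Unique P → length P ≡ suc (2 ^ length L) →
                     AgreeOutside ρ P L → Refutable (BinPHP m k) (queryDepth (length L)) ρ
  binPHP-refutable [] {P = j ∷ j' ∷ []} ((j≢j' ∷ []) ∷ [] ∷ []) _ agree =
    binClause j j' a , axiom (j , j' , a , j≢j' , λ _ → refl) ,
    InHole⇒falsifies-binClause (in-hole λ ℓ → All.head (proj₂ (agree ℓ λ ())))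
                               (in-hole λ ℓ → All.head (All.tail (proj₂ (agree ℓ λ ())))) ,
    ≤-refl
    where
    a : Hole k
    a ℓ = proj₁ (agree ℓ λ ())
  binPHP-refutable (ℓ ∷ L) {ρ} {P} unique |P| agree =
    subst (λ n → Refutable (BinPHP m k) (n + queryDepth (length L)) ρ) (trans (length-map _ P) |P|)
          (refutable-query (map (_, ℓ) P) refine)
    where
    t : ℕ
    t = 2 ^ length L

    refine : ∀ σ → ρ ⊑ σ → All (Assigned σ) (map (_, ℓ) P) →
             Refutable (BinPHP m k) (queryDepth (length L)) σ
    refine σ ρ⊑σ assigned with majority (λ j → σ j ℓ) t (All.map⁻ assigned) (≤-reflexive (sym |P|))
    ... | v , many = binPHP-refutable L (Unique.take⁺ (suc t) (Unique.filter⁺ agrees? unique)) |Q| agreeQ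
      where
      agrees? : ∀ j → Dec (σ j ℓ ≡ just v)
      agrees? j = σ j ℓ ≟ᴹ just v

      Q : List (Fin m)
      Q = take (suc t) (filter agrees? P)

      |Q| : length Q ≡ suc t
      |Q| = trans (length-take (suc t) (filter agrees? P)) (m≤n⇒m⊓n≡m many)

      agreeQ : AgreeOutside σ Q L
      agreeQ ℓ' ℓ'∉L with ℓ' ≟ᶠ ℓ
      ... | yes refl  = v , All.take⁺ (suc t) (All.all-filter agrees? P)
      ... | no ℓ'≢ℓ with agree ℓ' (λ { (here e) → ℓ'≢ℓ e ; (there e) → ℓ'∉L e })
      ...   | w , ρP = w , All.take⁺ (suc t) (All.filter⁺ agrees? (All.map (ρ⊑σ _ ℓ') ρP))

  binPHP-upper-bound : 2 ^ k < m → Σ (Refutation (BinPHP m k)) λ π → suc (size π) ≤ 2 ^ queryDepth k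
  binPHP-upper-bound n<m =
    refutation-from-refutable {d = queryDepth k} binPHP-extensional
      (subst (λ r → Refutable (BinPHP m k) (queryDepth r) (λ _ _ → nothing)) (length-allFin k)
             (binPHP-refutable (allFin k) (Unique.take⁺ (suc (2 ^ k)) (Unique.allFin⁺ m)) |P|
                               λ ℓ ℓ∉ → contradiction (∈-allFin ℓ) ℓ∉))
    where
    length-allFin : ∀ n → length (allFin n) ≡ n
    length-allFin n = length-tabulate id

    |P| : length (take (suc (2 ^ k)) (allFin m)) ≡ suc (2 ^ length (allFin k))
    |P| = begin
      length (take (suc (2 ^ k)) (allFin m)) ≡⟨ length-take (suc (2 ^ k)) (allFin m) ⟩
      suc (2 ^ k) ⊓ length (allFin m)        ≡⟨ m≤n⇒m⊓n≡m (subst (_ ≤_) (sym (length-allFin m)) n<m) ⟩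
      suc (2 ^ k)                            ≡⟨ cong (λ r → suc (2 ^ r)) (sym (length-allFin k)) ⟩
      suc (2 ^ length (allFin k))            ∎
      where open ≡-Reasoning

-- Lower bound for BinPHP

-- hole p false and hole p true are complementary.
hole : ∀ {k} → Hole k → Bool → Hole (suc k)
hole p s zero    = s
hole p s (suc ℓ) = p ℓ xor s

hole-reaches : ∀ {k} (p : Hole k) ℓ b → ∃ λ s → hole p s ℓ ≡ b
hole-reaches p zero    b = b , refl
hole-reaches p (suc ℓ) b =
  p ℓ xor b , trans (sym (xor-assoc (p ℓ) (p ℓ) b)) (cong (_xor b) (xor-same (p ℓ)))

hole-injective : ∀ {k} {p p' : Hole k} {s s'} → hole p s ≗ hole p' s' → p ≗ p'
hole-injective {p = p} {p'} {s} eq ℓ with refl ← eq zero = begin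
  p ℓ                ≡⟨ sym (xor-cancelʳ (p ℓ)) ⟩
  (p ℓ xor s) xor s  ≡⟨ cong (_xor s) (eq (suc ℓ)) ⟩
  (p' ℓ xor s) xor s ≡⟨ xor-cancelʳ (p' ℓ) ⟩
  p' ℓ               ∎
  where
  open ≡-Reasoning
  xor-cancelʳ : ∀ x → (x xor s) xor s ≡ x
  xor-cancelʳ x = trans (xor-assoc x s s) (trans (cong (x xor_) (xor-same s)) (xor-identityʳ x))

allHoles : ∀ k → List (Hole k)
allHoles zero    = (λ ()) ∷ []
allHoles (suc k) = map (false V.∷_) (allHoles k) ++ map (true V.∷_) (allHoles k)

length-allHoles : ∀ k → length (allHoles k) ≡ 2 ^ k
length-allHoles zero    = refl
length-allHoles (suc k) = begin
  length (map (false V.∷_) (allHoles k) ++ map (true V.∷_) (allHoles k))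
    ≡⟨ length-++ (map (false V.∷_) (allHoles k)) ⟩
  length (map (false V.∷_) (allHoles k)) + length (map (true V.∷_) (allHoles k))
    ≡⟨ cong₂ _+_ (length-map _ (allHoles k)) (length-map _ (allHoles k)) ⟩
  length (allHoles k) + length (allHoles k)
    ≡⟨ cong₂ _+_ (length-allHoles k) (length-allHoles k) ⟩
  2 ^ k + 2 ^ k
    ≡⟨ sym (2^[1+n]≡2^n+2^n k) ⟩
  2 ^ suc k ∎
  where open ≡-Reasoning

allHoles-distinct : ∀ k → AllPairs (λ p q → ¬ p ≗ q) (allHoles k)
allHoles-distinct zero    = [] ∷ []
allHoles-distinct (suc k) =
  AllPairs.++⁺ (AllPairs.map⁺ (AllPairs.map (tails-differ false) (allHoles-distinct k)))
               (AllPairs.map⁺ (AllPairs.map (tails-differ true) (allHoles-distinct k)))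
               (All.map⁺ (All.universal (λ _ → All.map⁺ (All.universal (λ _ → heads-differ) (allHoles k)))
                                        (allHoles k)))
  where
  tails-differ : ∀ b {p q : Hole k} → ¬ p ≗ q → ¬ (b V.∷ p) ≗ (b V.∷ q)
  tails-differ _ p≉q eq = p≉q (λ ℓ → eq (suc ℓ))

  heads-differ : ∀ {p q : Hole k} → ¬ (false V.∷ p) ≗ (true V.∷ q)
  heads-differ eq = contradiction (eq zero) λ ()

module _ {m k : ℕ} where

  place : Partial m k → Fin m → Hole k → Partial m k
  place ρ i h = V.updateAt ρ i (λ _ ℓ → just (h ℓ))

  InHole-place : ∀ ρ i h → InHole (place ρ i h) i h
  InHole-place ρ i h = in-hole λ ℓ → cong-app (updateAt-updates i ρ) ℓ

  InHole-place⇒≗ : ∀ {ρ i h a} → InHole (place ρ i h) i a → a ≗ h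
  InHole-place⇒≗ {ρ} {i} {h} in-i ℓ =
    just-injective (trans (sym (bit in-i ℓ)) (bit (InHole-place ρ i h) ℓ))

  place-other : ∀ {ρ i j} h → j ≢ i → place ρ i h j ≡ ρ j
  place-other {ρ} {i} {j} h j≢i = updateAt-minimal j i ρ j≢i

  InHole-place-other : ∀ {ρ i j h a} → j ≢ i → InHole (place ρ i h) j a → InHole ρ j a
  InHole-place-other {h = h} j≢i in-j =
    in-hole λ ℓ → trans (sym (cong-app (place-other h j≢i) ℓ)) (bit in-j ℓ)

  InHole-other-place : ∀ {ρ i j h a} → j ≢ i → InHole ρ j a → InHole (place ρ i h) j a
  InHole-other-place {h = h} j≢i in-j =
    in-hole λ ℓ → trans (cong-app (place-other h j≢i) ℓ) (bit in-j ℓ)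

  InHole-≗ : ∀ {ρ : Partial m k} {j a b} → InHole ρ j a → a ≗ b → InHole ρ j b
  InHole-≗ in-j a≗b = in-hole λ ℓ → trans (bit in-j ℓ) (cong just (a≗b ℓ))

module _ {m k : ℕ} where

  -- Every p in free stands for the unused pair of holes hole p false and hole p true.
  record Position (free : List (Hole k)) (ρ : Partial m (suc k)) : Set where
    field
      free-distinct      : AllPairs (λ p q → ¬ p ≗ q) free
      free-unused        : All (λ p → ∀ s j → ¬ InHole ρ j (hole p s)) free
      placed-or-unplaced : ∀ j → (∀ ℓ → ρ j ℓ ≡ nothing) ⊎ ∃ (InHole ρ j)
      holes-distinct     : ∀ {j j' h} → InHole ρ j h → InHole ρ j' h → j ≡ j'

  open Position

  nobody-placed : ∀ {j} {a : Hole (suc k)} → ¬ InHole {m} (λ _ _ → nothing) j a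
  nobody-placed in-j = contradiction (bit in-j zero) λ ()

  initial-position : Position (allHoles k) (λ _ _ → nothing)
  initial-position = record
    { free-distinct      = allHoles-distinct k
    ; free-unused        = All.universal (λ _ _ _ → nobody-placed) (allHoles k)
    ; placed-or-unplaced = λ _ → inj₁ (λ _ → refl)
    ; holes-distinct     = λ in-j _ → contradiction in-j nobody-placed
    }

  place-position : ∀ {p free ρ i} s → Position (p ∷ free) ρ → (∀ ℓ → ρ i ℓ ≡ nothing) →
                   Position free (place ρ i (hole p s))
  place-position {p} {free} {ρ} {i} s pos unplaced = record
    { free-distinct      = AllPairs.tail (free-distinct pos)
    ; free-unused        = All.zipWith unused
                             (AllPairs.head (free-distinct pos) , All.tail (free-unused pos))
    ; placed-or-unplaced = placed-or-unplaced′
    ; holes-distinct     = holes-distinct′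
    }
    where
    σ : Partial m (suc k)
    σ = place ρ i (hole p s)

    in-hole-at-i : ∀ {a} → InHole σ i a → a ≗ hole p s
    in-hole-at-i = InHole-place⇒≗ {ρ = ρ}

    in-hole-elsewhere : ∀ {j a} → j ≢ i → InHole σ j a → InHole ρ j a
    in-hole-elsewhere = InHole-place-other {ρ = ρ} {h = hole p s}

    p-unused : ∀ s' j → ¬ InHole ρ j (hole p s')
    p-unused = All.head (free-unused pos)

    unused : ∀ {q} → (¬ p ≗ q) × (∀ s' j → ¬ InHole ρ j (hole q s')) → ∀ s' j → ¬ InHole σ j (hole q s')
    unused {q} (p≉q , q-unused) s' j in-j with j ≟ᶠ i
    ... | yes refl = p≉q (hole-injective (λ ℓ → sym (in-hole-at-i in-j ℓ)))
    ... | no j≢i   = q-unused s' j (in-hole-elsewhere j≢i in-j)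

    placed-or-unplaced′ : ∀ j → (∀ ℓ → σ j ℓ ≡ nothing) ⊎ ∃ (InHole σ j)
    placed-or-unplaced′ j with j ≟ᶠ i
    ... | yes refl = inj₂ (hole p s , InHole-place ρ i (hole p s))
    ... | no j≢i with placed-or-unplaced pos j
    ...   | inj₁ unplaced-j = inj₁ λ ℓ → trans (cong-app (place-other (hole p s) j≢i) ℓ) (unplaced-j ℓ)
    ...   | inj₂ (h , in-j) = inj₂ (h , InHole-other-place {ρ = ρ} j≢i in-j)

    holes-distinct′ : ∀ {j j' h} → InHole σ j h → InHole σ j' h → j ≡ j'
    holes-distinct′ {j} {j'} in-j in-j' with j ≟ᶠ i | j' ≟ᶠ i
    ... | yes refl | yes refl = refl
    ... | yes refl | no j'≢i  =
      contradiction (InHole-≗ (in-hole-elsewhere j'≢i in-j') (in-hole-at-i in-j)) (p-unused s j')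
    ... | no j≢i   | yes refl =
      contradiction (InHole-≗ (in-hole-elsewhere j≢i in-j) (in-hole-at-i in-j')) (p-unused s j)
    ... | no j≢i   | no j'≢i  =
      holes-distinct pos (in-hole-elsewhere j≢i in-j) (in-hole-elsewhere j'≢i in-j')

  FreePairs : ℕ → Partial m (suc k) → Set
  FreePairs r ρ = ∃ λ free → length free ≡ r × Position free ρ

  binPHP-delayer : DelayerStrategy (BinPHP m (suc k))
  binPHP-delayer = record
    { Safe            = FreePairs
    ; safe-consistent = consistent
    ; safe-branch     = branch
    }
    where
    consistent : ∀ {r ρ C} → FreePairs r ρ → BinPHP m (suc k) C → ¬ Falsifies ρ C
    consistent (_ , _ , pos) (i , i' , a , i≢i' , C≗) ρ⊭C
      with falsifies-binClause⇒InHole (λ l e → ρ⊭C l (trans (C≗ l) e))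
    ... | in-i , in-i' = i≢i' (holes-distinct pos in-i in-i')

    branch : ∀ {r ρ} i ℓ → FreePairs (suc r) ρ → ρ i ℓ ≡ nothing →
             ∀ v → Σ (Partial m (suc k)) λ σ → ρ ⊑ σ × σ i ℓ ≡ just v × FreePairs r σ
    branch {ρ = ρ} i ℓ (p ∷ free , |free| , pos) ρx v with hole-reaches p ℓ v | placed-or-unplaced pos i
    ... | _ | inj₂ (_ , in-i) = contradiction (trans (sym ρx) (bit in-i ℓ)) λ ()
    ... | s , hole≡v | inj₁ unplaced =
      place ρ i (hole p s) , ρ⊑σ , trans (bit (InHole-place ρ i (hole p s)) ℓ) (cong just hole≡v) ,
      free , suc-injective |free| , place-position s pos unplaced
      where
      ρ⊑σ : ρ ⊑ place ρ i (hole p s)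
      ρ⊑σ j ℓ' ρj with j ≟ᶠ i
      ... | yes refl = contradiction (trans (sym (unplaced ℓ')) ρj) λ ()
      ... | no j≢i   = trans (cong-app (place-other (hole p s) j≢i) ℓ') ρj

  binPHP-lower-bound : (π : Refutation (BinPHP m (suc k))) → 2 ^ 2 ^ k ≤ suc (size π)
  binPHP-lower-bound =
    delayer-lower-bound binPHP-delayer (allHoles k , length-allHoles k , initial-position) λ _ ()

≤-pred-double : ∀ {y S} → 0 < y → 2 * y ≤ suc S → y ≤ S
≤-pred-double {suc y} {S} _ (s≤s 2y≤S) = begin
  suc y             ≤⟨ m≤n+m (suc y) y ⟩
  y + suc y         ≡⟨ cong (y +_) (sym (+-identityʳ (suc y))) ⟩
  y + (suc y + 0)   ≤⟨ 2y≤S ⟩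
  S                 ∎
  where open ≤-Reasoning

2^2^-pred : ∀ k S → 2 ^ 2 ^ suc k ≤ suc S → 2 ^ 2 ^ k ≤ S
2^2^-pred k S h = ≤-pred-double (m^n>0 2 (2 ^ k)) (≤-trans (^-monoʳ-≤ 2 1+x≤2x) h)
  where
  1+x≤2x : suc (2 ^ k) ≤ 2 * 2 ^ k
  1+x≤2x = subst (suc (2 ^ k) ≤_) (cong (2 ^ k +_) (sym (+-identityʳ (2 ^ k))))
                 (+-monoˡ-≤ (2 ^ k) (m^n>0 2 k))

2^[2+k]/4≡2^k : ∀ k → 2 ^ suc (suc k) / 4 ≡ 2 ^ k
2^[2+k]/4≡2^k k = trans (cong (_/ 4) 2^[2+k]≡2^k*4) (m*n/n≡m (2 ^ k) 4)
  where
  2^[2+k]≡2^k*4 : 2 ^ suc (suc k) ≡ 2 ^ k * 4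
  2^[2+k]≡2^k*4 = trans (sym (*-assoc 2 2 (2 ^ k))) (*-comm 4 (2 ^ k))

queryDepth-≤ : ∀ r → queryDepth r ≤ 4 * 2 ^ r
queryDepth-≤ zero    = z≤n
queryDepth-≤ (suc r) = begin
  suc (2 * t) + queryDepth r      ≤⟨ +-mono-≤ (+-monoˡ-≤ (2 * t) (m^n>0 2 r)) (queryDepth-≤ r) ⟩
  t + 2 * t + 4 * t               ≤⟨ m≤n+m _ t ⟩
  t + (t + 2 * t + 4 * t)         ≡⟨ solve t ⟩
  4 * (2 * t)                     ∎
  where
  open ≤-Reasoning
  t : ℕ
  t = 2 ^ r
  solve : ∀ t → t + (t + 2 * t + 4 * t) ≡ 4 * (2 * t)
  solve = solve-∀

theorem4p9 : Σ ℕ λ c → Σ ℕ λ n₀ → (k m : ℕ) → n₀ ≤ 2 ^ k → 2 ^ k < m →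
    (Σ (Refutation (BinPHP m k)) λ π → size π ≤ 2 ^ (suc c * 2 ^ k))
    × ((π : Refutation (BinPHP m k)) → 2 ^ (2 ^ k / suc c) ≤ size π)
theorem4p9 = 3 , 4 , bounds
  where
  bounds : (k m : ℕ) → 4 ≤ 2 ^ k → 2 ^ k < m →
    (Σ (Refutation (BinPHP m k)) λ π → size π ≤ 2 ^ (4 * 2 ^ k))
    × ((π : Refutation (BinPHP m k)) → 2 ^ (2 ^ k / 4) ≤ size π)
  bounds zero          m (s≤s ())       _
  bounds (suc zero)    m (s≤s (s≤s ())) _
  bounds (suc (suc k)) m _ n<m = upper , lower
    where
    upper : Σ (Refutation (BinPHP m (suc (suc k)))) λ π → size π ≤ 2 ^ (4 * 2 ^ suc (suc k))
    upper with binPHP-upper-bound n<m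
    ... | π , leaves =
      π , ≤-trans (n≤1+n _) (≤-trans leaves (^-monoʳ-≤ 2 (queryDepth-≤ (suc (suc k)))))

    lower : (π : Refutation (BinPHP m (suc (suc k)))) → 2 ^ (2 ^ suc (suc k) / 4) ≤ size π
    lower π rewrite 2^[2+k]/4≡2^k k = 2^2^-pred k (size π) (binPHP-lower-bound π)
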